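{- Let $S\subseteq\mathbb{N}^\mathbb{N}$. For every ordinal $\alpha$, $\mathrm{Rm}_{\alpha}(S)=[S_{\alpha}]$.
   Context: $\mathbb{N}^\mathbb{N}$ is the set of functions $\mathbb{N}\to\mathbb{N}$ and $\mathbb{N}^{<\mathbb{N}}=\bigcup_n\mathbb{N}^n$ the set of finite sequences. For $s\in\mathbb{N}^{<\mathbb{N}}$, $[s]=\{f\in\mathbb{N}^\mathbb{N}: f \text{ extends } s\}$; $\mathbb{N}^\mathbb{N}$ carries the topology with basic open sets $[s]$, and $\overline{\,\cdot\,}$ denotes topological closure. For $X\subseteq\mathbb{N}^{<\mathbb{N}}$, $[X]$ denotes the set of $f\in\mathbb{N}^\mathbb{N}$ all of whose finite initial segments lie in $X$. For $A,B\subseteq\mathbb{N}^\mathbb{N}$ define $\mathrm{Rm}_0(A,B)=\mathbb{N}^\mathbb{N}$ and for ordinals $\mu>0$, $\mathrm{Rm}_\mu(A,B)=\bigcap_{\nu<\mu}\left(\overline{\mathrm{Rm}_\nu(A,B)\cap A}\cap\overline{\mathrm{Rm}_\nu(A,B)\cap B}\right)$; write $\mathrm{Rm}_\mu(S)=\mathrm{Rm}_\mu(S,\mathbb{N}^\mathbb{N}\setminus S)$. Define $S_\alpha\subseteq\mathbb{N}^{<\mathbb{N}}$ by transfinite recursion: $S_0=\mathbb{N}^{<\mathbb{N}}$; $S_\lambda=\bigcap_{\beta<\lambda}S_\beta$ for limit $\lambda$; and $S_{\beta+1}=\{x\in S_\beta: \exists x',x''\in[S_\beta] \text{ with } x\subseteq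 x',\ x\subseteq x'',\ x'\in S,\ x''\notin S\}$. -}

module Defs where

open import Level using (Level; _⊔_) renaming (zero to lzero; suc to lsuc)
open import Data.Nat using (ℕ)
open import Data.List using (List; length; map; upTo)
open import Data.Product using (Σ; _×_; ∃)
open import Relation.Nullary using (¬_)
open import Data.Unit using (⊤)
open import Relation.Binary.PropositionalEquality using (_≡_)

Baire : Set
Baire = ℕ → ℕ

Seq : Set
Seq = List ℕ

_↾_ : Baire → ℕ → Seq
f ↾ n = map f (upTo n)

_⊑_ : Seq → Baire → Set
x ⊑ f = f ↾ length x ≡ x

⟦_⟧ : {ℓ : Level} → (Seq → Set ℓ) → Baire → Set ℓ
⟦ X ⟧ f = ∀ n → X (f ↾ n)

-- topological closure in Baire space (basic open nbhds of f are [f ↾ n])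
cl : {ℓ : Level} → (Baire → Set ℓ) → Baire → Set ℓ
cl A f = ∀ n → ∃ λ g → (g ↾ n ≡ f ↾ n) × A g

data Ord : Set₁ where
  ozero : Ord
  osuc  : Ord → Ord
  olim  : {I : Set} → (I → Ord) → Ord

data _≤o_ : Ord → Ord → Set₁ where
  ≤-zero     : {x : Ord} → ozero ≤o x
  ≤-suc-mono : {x y : Ord} → x ≤o y → osuc x ≤o osuc y
  ≤-cocone   : {x : Ord} {I : Set} (f : I → Ord) (k : I) → x ≤o f k → x ≤o olim f
  ≤-limiting : {x : Ord} {I : Set} (f : I → Ord) → (∀ k → f k ≤o x) → olim f ≤o x

_<o_ : Ord → Ord → Set₁
x <o y = osuc x ≤o y

-- Rm_μ(S) is specified by its defining (transfinite-recursion) equation: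
-- Rm_μ = ⋂_{ν<μ} ( cl(Rm_ν ∩ S) ∩ cl(Rm_ν ∖ S) )   (for μ = 0 this is all of ℕ^ℕ)
IsRm : (S : Baire → Set) → (Ord → Baire → Set₁) → Set₁
IsRm S R = ∀ μ f →
  (R μ f → ∀ ν → ν <o μ → cl (λ g → R ν g × S g) f × cl (λ g → R ν g × ¬ S g) f)
  × ((∀ ν → ν <o μ → cl (λ g → R ν g × S g) f × cl (λ g → R ν g × ¬ S g) f) → R μ f)

Sα : (S : Baire → Set) → Ord → Seq → Set
Sα S ozero x = ⊤
Sα S (osuc β) x =
  Sα S β x ×
  (∃ λ (x' : Baire) → ∃ λ (x'' : Baire) →
     ⟦ Sα S β ⟧ x' × ⟦ Sα S β ⟧ x'' × x ⊑ x' × x ⊑ x'' × S x' × ¬ S x'')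
Sα S (olim {I} h) x = ∀ (i : I) → Sα S (h i) x

-- Both sides satisfy the same recursion.  On the tree side, f ∈ [S_{β+1}] iff every
-- neighbourhood of f meets [S_β] ∩ S and [S_β] ∖ S (the witnesses x', x'' of S_{β+1} are
-- exactly such points), and [S_λ] = ⋂_{β<λ} [S_β] at limits.  On the Rm side, Rm is
-- antitone in μ, so Rm_{β+1} only depends on the stage β and Rm_λ = ⋂_{β<λ} Rm_β.
-- Transfinite induction on the Brouwer tree α then identifies the two.
module Submission where

open import Defs
open import Level using (Level)
open import Data.Product using (_×_; _,_; proj₁; proj₂)
open import Data.List using (length; upTo)
open import Data.List.Properties using (length-map; length-upTo)
open import Data.Unit using (tt)
open import Function.Bundles using (_⇔_; mk⇔; Equivalence)
open import Relation.Binary.PropositionalEquality using (_≡_; refl; sym; trans; cong; subst)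
open import Relation.Nullary using (¬_)

private
  variable
    a b : Level

≤o-refl : ∀ {x} → x ≤o x
≤o-refl {ozero}  = ≤-zero
≤o-refl {osuc x} = ≤-suc-mono ≤o-refl
≤o-refl {olim f} = ≤-limiting f (λ k → ≤-cocone f k ≤o-refl)

≤o-trans : ∀ {x y z} → x ≤o y → y ≤o z → x ≤o z
≤o-trans ≤-zero                 q                    = ≤-zero
≤o-trans (≤-suc-mono p)         (≤-suc-mono q)       = ≤-suc-mono (≤o-trans p q)
≤o-trans p@(≤-suc-mono _)       (≤-cocone f k q)     = ≤-cocone f k (≤o-trans p q)
≤o-trans (≤-cocone f k p)       (≤-limiting .f g)    = ≤o-trans p (g k)
≤o-trans p@(≤-cocone _ _ _)     (≤-cocone f k q)     = ≤-cocone f k (≤o-trans p q)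
≤o-trans (≤-limiting f g)       q                    = ≤-limiting f (λ k → ≤o-trans (g k) q)

length-↾ : ∀ (f : Baire) n → length (f ↾ n) ≡ n
length-↾ f n = trans (length-map f (upTo n)) (length-upTo n)

↾-agree⇒⊑ : ∀ {f g : Baire} n → g ↾ n ≡ f ↾ n → (f ↾ n) ⊑ g
↾-agree⇒⊑ {f} {g} n e = trans (cong (g ↾_) (length-↾ f n)) e

⊑⇒↾-agree : ∀ {f g : Baire} n → (f ↾ n) ⊑ g → g ↾ n ≡ f ↾ n
⊑⇒↾-agree {f} {g} n e = trans (cong (g ↾_) (sym (length-↾ f n))) e

cl-mono : {A : Baire → Set a} {B : Baire → Set b} →
  (∀ g → A g → B g) → ∀ f → cl A f → cl B f
cl-mono A⊆B f c n with c n
... | g , e , x = g , e , A⊆B g x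

Splits : (Baire → Set a) → (Baire → Set) → Baire → Set a
Splits A S f = cl (λ g → A g × S g) f × cl (λ g → A g × ¬ S g) f

Splits-mono : {A : Baire → Set a} {B : Baire → Set b} (S : Baire → Set) →
  (∀ g → A g → B g) → ∀ f → Splits A S f → Splits B S f
Splits-mono S A⊆B f (c , c̸) =
  cl-mono (λ g (x , s) → A⊆B g x , s) f c , cl-mono (λ g (x , s) → A⊆B g x , s) f c̸

module _ (S : Baire → Set) where

  ⟦Sα-suc⟧⇔Splits : ∀ β f → ⟦ Sα S (osuc β) ⟧ f ⇔ Splits ⟦ Sα S β ⟧ S f
  ⟦Sα-suc⟧⇔Splits β f = mk⇔ to from
    where
    to : ⟦ Sα S (osuc β) ⟧ f → Splits ⟦ Sα S β ⟧ S f
    to s = (λ n → let (_ , g , _ , sg , _ , eg , _ , Sg , _) = s n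
                  in g , ⊑⇒↾-agree n eg , sg , Sg)
         , (λ n → let (_ , _ , h , _ , sh , _ , eh , _ , S̸h) = s n
                  in h , ⊑⇒↾-agree n eh , sh , S̸h)
    from : Splits ⟦ Sα S β ⟧ S f → ⟦ Sα S (osuc β) ⟧ f
    from (c , c̸) n =
      let (g , eg , sg , Sg)  = c n
          (h , eh , sh , S̸h) = c̸ n
      in subst (Sα S β) eg (sg n) , g , h , sg , sh , ↾-agree⇒⊑ n eg , ↾-agree⇒⊑ n eh , Sg , S̸h

  ⟦Sα-lim⟧⇔⋂ : ∀ {I} (h : I → Ord) f → ⟦ Sα S (olim h) ⟧ f ⇔ (∀ i → ⟦ Sα S (h i) ⟧ f)
  ⟦Sα-lim⟧⇔⋂ h f = mk⇔ (λ s i n → s n i) (λ s n i → s i n)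

  module _ (Rm : Ord → Baire → Set₁) (isRm : IsRm S Rm) where

    Rm-antitone : ∀ {μ β} f → μ ≤o β → Rm β f → Rm μ f
    Rm-antitone {μ} {β} f μ≤β r =
      proj₂ (isRm μ f) (λ ν ν<μ → proj₁ (isRm β f) r ν (≤o-trans ν<μ μ≤β))

    Rm-suc⇔Splits : ∀ β f → Rm (osuc β) f ⇔ Splits (Rm β) S f
    Rm-suc⇔Splits β f = mk⇔
      (λ r → proj₁ (isRm (osuc β) f) r β ≤o-refl)
      (λ split → proj₂ (isRm (osuc β) f) λ where
        ν (≤-suc-mono ν≤β) → Splits-mono S (λ g → Rm-antitone g ν≤β) f split)

    Rm-lim⇔⋂ : ∀ {I} (h : I → Ord) f → Rm (olim h) f ⇔ (∀ i → Rm (h i) f)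
    Rm-lim⇔⋂ h f = mk⇔
      (λ r i → Rm-antitone f (≤-cocone h i ≤o-refl) r)
      (λ r → proj₂ (isRm (olim h) f) λ where
        ν (≤-cocone .h i ν<hi) → proj₁ (isRm (h i) f) (r i) ν ν<hi)

    Rm⇔⟦Sα⟧ : ∀ α f → Rm α f ⇔ ⟦ Sα S α ⟧ f
    Rm⇔⟦Sα⟧ ozero    f = mk⇔ (λ _ _ → tt) (λ _ → proj₂ (isRm ozero f) (λ _ ()))
    Rm⇔⟦Sα⟧ (osuc β) f = mk⇔
      (λ r → from (⟦Sα-suc⟧⇔Splits β f)
               (Splits-mono S (λ g → to (Rm⇔⟦Sα⟧ β g)) f (to (Rm-suc⇔Splits β f) r)))
      (λ s → from (Rm-suc⇔Splits β f)
               (Splits-mono S (λ g → from (Rm⇔⟦Sα⟧ β g)) f (to (⟦Sα-suc⟧⇔Splits β f) s)))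
      where open Equivalence
    Rm⇔⟦Sα⟧ (olim h) f = mk⇔
      (λ r → from (⟦Sα-lim⟧⇔⋂ h f) (λ i → to (Rm⇔⟦Sα⟧ (h i) f) (to (Rm-lim⇔⋂ h f) r i)))
      (λ s → from (Rm-lim⇔⋂ h f) (λ i → from (Rm⇔⟦Sα⟧ (h i) f) (to (⟦Sα-lim⟧⇔⋂ h f) s i)))
      where open Equivalence

lemma2p2 : (S : Baire → Set) (Rm : Ord → Baire → Set₁) → IsRm S Rm →
    ∀ (α : Ord) (f : Baire) → (Rm α f → ⟦ Sα S α ⟧ f) × (⟦ Sα S α ⟧ f → Rm α f)
lemma2p2 S Rm isRm α f = to , from
  where open Equivalence (Rm⇔⟦Sα⟧ S Rm isRm α f)
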